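{- Let $\pi\in S_n$ and let $\pi_i$ be a left-to-right minimum of $\pi$ with $i>1$. Let $j\le n$ be the largest index such that $\pi_i=\min(\pi_1,\pi_2,\dots,\pi_j)$. Then $s_{123,132}(\pi)_{j-1}=\pi_i$.
   Context: $S_n$ is the set of permutations of $\{1,\dots,n\}$ in one-line notation $\pi=\pi_1\cdots\pi_n$. An entry $\pi_i$ is a left-to-right minimum of $\pi$ if $\pi_i=\min(\pi_1,\dots,\pi_i)$. A sequence of distinct integers contains a pattern $\rho\in S_m$ if it has a subsequence in the same relative order as $\rho$; otherwise it avoids $\rho$. The map $s_{123,132}:S_n\to S_n$: read the entries of $\pi$ left to right using one stack (initially empty); at each step, if there is a remaining input entry $x$ and placing $x$ on top of the stack gives a stack whose contents read from top to bottom avoid both $123$ and $132$, push $x$ (pushing has priority); otherwise pop the top of the stack to the output. When the input is exhausted, pop the remaining stack entries from the top to the output. The output is $s_{123,132}(\pi)$, and $s_{123,132}(\pi)_k$ denotes its $k$-th entry. -}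

module Defs where

open import Data.Nat using (ℕ; zero; suc; _<ᵇ_; _⊓_)
open import Data.Bool using (Bool; true; false; _∧_; _∨_; not; if_then_else_)
open import Data.List using (List; []; _∷_; _++_; map; upTo; take; reverse)
open import Data.Bool.ListAction using (any)
open import Data.Maybe using (Maybe; just; nothing)
open import Data.Product using (_×_; _,_)

-- S_n: lists that are permutations of [1,...,n]
oneTo : ℕ → List ℕ
oneTo n = map suc (upTo n)

-- 1-based lookup: nth1 l k = just l_k  (nothing if k = 0 or k > length)
nth1 : List ℕ → ℕ → Maybe ℕ
nth1 []       _             = nothing
nth1 (x ∷ xs) zero          = nothing
nth1 (x ∷ xs) (suc zero)    = just x
nth1 (x ∷ xs) (suc (suc k)) = nth1 xs (suc k)

minList : List ℕ → Maybe ℕ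
minList []       = nothing
minList (x ∷ xs) with minList xs
... | nothing = just x
... | just m  = just (x ⊓ m)

prefMin : List ℕ → ℕ → Maybe ℕ
prefMin π j = minList (take j π)

pairs : List ℕ → List (ℕ × ℕ)
pairs []       = []
pairs (x ∷ xs) = map (λ y → (x , y)) xs ++ pairs xs

triples : List ℕ → List (ℕ × ℕ × ℕ)
triples []       = []
triples (x ∷ xs) = map (λ p → (x , p)) (pairs xs) ++ triples xs

is123 : ℕ × ℕ × ℕ → Bool
is123 (a , b , c) = (a <ᵇ b) ∧ (b <ᵇ c)

is132 : ℕ × ℕ × ℕ → Bool
is132 (a , b , c) = (a <ᵇ c) ∧ (c <ᵇ b)

avoids123-132 : List ℕ → Bool
avoids123-132 l = not (any (λ t → is123 t ∨ is132 t) (triples l))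

-- The stack sorting map s_{123,132}.
-- stack is a list with its head = top of stack; output is accumulated reversed.
mutual
  run : List ℕ → List ℕ → List ℕ → List ℕ
  run []       st out = reverse out ++ st
  run (x ∷ xs) st out = step x xs st out

  step : ℕ → List ℕ → List ℕ → List ℕ → List ℕ
  step x xs st out with avoids123-132 (x ∷ st)
  ... | true  = run xs (x ∷ st) out
  step x xs []       out | false = run xs (x ∷ []) out  -- unreachable: a single entry avoids both
  step x xs (y ∷ st) out | false = step x xs st (y ∷ out)

s123-132 : List ℕ → List ℕ
s123-132 π = run π [] []

-- Write π = A v B C with v = π_i, where A v B are the first j entries. The entries of A (nonempty,
-- as i > 1) and of B exceed v, and by maximality of j, C is empty or starts below v. When v arrives,
-- the stack holds distinct entries of A, and v followed by any two of them is a 123 or 132 pattern,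
-- so the stack is popped down to a single entry y > v before v is pushed. While B is read, v y stays
-- at the bottom of the stack, since x v y with v smallest is no pattern. So exactly the j − 2 entries
-- output so far and those on the stack above v precede v in the output: if C is empty the stack is
-- emptied top first, and if C starts with c < v, then c v y is a 123 pattern, so everything down to
-- v is popped before c is pushed.

module Submission where

open import Defs
open import Data.Nat using (ℕ; _<_; _≤_; _∸_)
open import Data.List using (List)
open import Data.Maybe using (just)
open import Relation.Binary.PropositionalEquality using (_≡_; _≢_)
open import Data.List.Relation.Binary.Permutation.Propositional using (_↭_)

open import Data.Bool using (true; false; not; _∨_; T)
open import Data.Bool.Properties using (T-≡; T-∧; T-∨; ∧-zeroʳ)
open import Data.Nat using (zero; suc; _+_; _⊓_; _<ᵇ_; s≤s; z≤n)
open import Data.Nat.Properties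
open import Data.List using ([]; _∷_; _++_; _ʳ++_; reverse; length; take; drop; head; upTo)
open import Data.List.Properties
  using ( ++-assoc; ++-identityʳ; ʳ++-defn; take++drop≡id
        ; length-++; length-ʳ++; length-reverse; length-map; length-upTo; length-take)
open import Data.List.Membership.Propositional using (_∈_; _∉_)
open import Data.List.Membership.Propositional.Properties using (∈-++⁺ˡ; ∈-++⁺ʳ; ∈-map⁺; ∈-∃++)
open import Data.List.Relation.Unary.All as All using (All; []; _∷_)
import Data.List.Relation.Unary.All.Properties as All
open import Data.List.Relation.Unary.Any as Any using (here; there)
open import Data.List.Relation.Unary.Any.Properties using (any⁺)
open import Data.List.Relation.Unary.AllPairs using ([]; _∷_)
open import Data.List.Relation.Unary.Unique.Propositional using (Unique)
import Data.List.Relation.Unary.Unique.Propositional.Properties as Unique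
open import Data.List.Relation.Binary.Permutation.Propositional using (prep; ↭-refl; ↭-sym; ↭-trans; ↭-reflexive; ↭⇒↭ₛ)
open import Data.List.Relation.Binary.Permutation.Propositional.Properties using (shift; ++⁺ˡ; ↭-length; All-resp-↭)
open import Data.List.Relation.Binary.Permutation.Setoid.Properties using (Unique-resp-↭)
open import Data.List.Relation.Binary.Sublist.Propositional using (_⊆_; _∷_; _∷ʳ_; ⊆-refl; to∈; minimum)
import Data.List.Relation.Binary.Sublist.Propositional.Properties as Sublist
import Data.Maybe.Relation.Unary.All as Maybe
open import Data.Maybe using (nothing)
open import Data.Product using (_×_; _,_; ∃; ∃₂)
open import Data.Sum using (inj₁; inj₂; [_,_]′)
open import Data.Unit using (tt)
open import Function using (_∘_)
open import Function.Bundles using (Equivalence)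
open import Relation.Binary.Definitions using (tri<; tri≈; tri>)
open import Relation.Binary.PropositionalEquality using (refl; sym; trans; cong; cong₂; subst; setoid; module ≡-Reasoning)
open import Relation.Nullary using (yes; no; contradiction)

open Equivalence using (to; from)

minList-nothing : ∀ {xs} → minList xs ≡ nothing → xs ≡ []
minList-nothing {[]}     _  = refl
minList-nothing {x ∷ xs} eq with minList xs
minList-nothing {x ∷ xs} () | nothing
minList-nothing {x ∷ xs} () | just _

minList-sound : ∀ {xs m} → minList xs ≡ just m → m ∈ xs × All (m ≤_) xs
minList-sound {x ∷ xs} eq with minList xs in e
minList-sound {x ∷ xs} refl | nothing with refl ← minList-nothing {xs} e = here refl , ≤-refl ∷ []
minList-sound {x ∷ xs} refl | just m with minList-sound e
... | m∈xs , m≤xs = x⊓m∈ , m⊓n≤m x m ∷ All.map (≤-trans (m⊓n≤n x m)) m≤xs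
  where
  x⊓m∈ : x ⊓ m ∈ x ∷ xs
  x⊓m∈ = [ here , (λ x⊓m≡m → there (subst (_∈ xs) (sym x⊓m≡m) m∈xs)) ]′ (⊓-sel x m)

minList-complete : ∀ {xs m} → m ∈ xs → All (m ≤_) xs → minList xs ≡ just m
minList-complete {xs} m∈xs m≤xs with minList xs in e
... | nothing = contradiction (subst (_ ∈_) (minList-nothing e) m∈xs) λ ()
... | just m′ = let m′∈xs , m′≤xs = minList-sound {xs} e in
  cong just (≤-antisym (All.lookup m′≤xs m∈xs) (All.lookup m≤xs m′∈xs))

minList-∷ʳ : ∀ {xs v c} → minList xs ≡ just v → v ≤ c → minList (xs ++ c ∷ []) ≡ just v
minList-∷ʳ {xs} min≡v v≤c = let v∈xs , v≤xs = minList-sound {xs} min≡v in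
  minList-complete (∈-++⁺ˡ v∈xs) (All.++⁺ v≤xs (v≤c ∷ []))

nth1-∈ : ∀ xs {k v} → nth1 xs k ≡ just v → v ∈ xs
nth1-∈ (x ∷ xs) {suc zero}    refl = here refl
nth1-∈ (x ∷ xs) {suc (suc k)} eq   = there (nth1-∈ xs eq)

nth1-++-∷ : ∀ xs {v ys} → nth1 (xs ++ v ∷ ys) (suc (length xs)) ≡ just v
nth1-++-∷ []       = refl
nth1-++-∷ (x ∷ xs) = nth1-++-∷ xs

head-take : ∀ {A : Set} j (xs : List A) {y ys} → take j xs ≡ y ∷ ys → head xs ≡ just y
head-take (suc j) (x ∷ xs) refl = refl

take-suc-drop : ∀ {A : Set} j (xs : List A) {c cs} → drop j xs ≡ c ∷ cs →
  take (suc j) xs ≡ take j xs ++ c ∷ []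
take-suc-drop zero    (x ∷ xs) refl = refl
take-suc-drop (suc j) (x ∷ xs) eq   = cong (x ∷_) (take-suc-drop j xs eq)

drop-∷⇒<length : ∀ {A : Set} j (xs : List A) {c cs} → drop j xs ≡ c ∷ cs → j < length xs
drop-∷⇒<length zero    (x ∷ xs) refl = s≤s z≤n
drop-∷⇒<length (suc j) (x ∷ xs) eq   = s≤s (drop-∷⇒<length j xs eq)

Unique-↭ : ∀ {A : Set} {xs ys : List A} → xs ↭ ys → Unique ys → Unique xs
Unique-↭ xs↭ys = Unique-resp-↭ (setoid _) (↭⇒↭ₛ (↭-sym xs↭ys))

Unique-++⁻ˡ : ∀ {A : Set} (xs : List A) {ys} → Unique (xs ++ ys) → Unique xs
Unique-++⁻ˡ []       _                 = []
Unique-++⁻ˡ (x ∷ xs) (x∉xs++ys ∷ uxs) = All.++⁻ˡ xs x∉xs++ys ∷ Unique-++⁻ˡ xs uxs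

later-entry≢head : ∀ {xs i v} → Unique xs → 1 < i → nth1 xs i ≡ just v → head xs ≢ just v
later-entry≢head {x ∷ xs} (x∉xs ∷ _) (s≤s (s≤s _)) xᵢ≡v refl = All.lookup x∉xs (nth1-∈ xs xᵢ≡v) refl

≤∧∉⇒< : ∀ {v xs} → All (v ≤_) xs → v ∉ xs → All (v <_) xs
≤∧∉⇒< []            _    = []
≤∧∉⇒< (v≤x ∷ v≤xs) v∉xs = ≤∧≢⇒< v≤x (v∉xs ∘ here) ∷ ≤∧∉⇒< v≤xs (v∉xs ∘ there)

Unique⇒strict-minimum : ∀ xs {v ys} → Unique (xs ++ v ∷ ys) → All (v ≤_) (xs ++ v ∷ ys) →
  All (v <_) xs × All (v <_) ys
Unique⇒strict-minimum xs {v} {ys} u v≤ =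
  All.++⁻ xs (≤∧∉⇒< (All.++⁺ (All.++⁻ˡ xs v≤) (All.tail (All.++⁻ʳ xs v≤))) v∉xs++ys)
  where
  v∉xs++ys : v ∉ xs ++ ys
  v∉xs++ys = Unique.Unique[x∷xs]⇒x∉xs (Unique-↭ (↭-sym (shift v xs ys)) u)

pairs-complete : ∀ {a b : ℕ} {l} → a ∷ b ∷ [] ⊆ l → (a , b) ∈ pairs l
pairs-complete (y ∷ʳ ab⊆l)  = ∈-++⁺ʳ _ (pairs-complete ab⊆l)
pairs-complete {a} (refl ∷ b⊆l) = ∈-++⁺ˡ (∈-map⁺ (a ,_) (to∈ b⊆l))

triples-complete : ∀ {a b c : ℕ} {l} → a ∷ b ∷ c ∷ [] ⊆ l → (a , b , c) ∈ triples l
triples-complete (y ∷ʳ abc⊆l)  = ∈-++⁺ʳ _ (triples-complete abc⊆l)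
triples-complete {a} (refl ∷ bc⊆l) = ∈-++⁺ˡ (∈-map⁺ (a ,_) (pairs-complete bc⊆l))

pattern⇒¬avoids : ∀ {a b c l} → a ∷ b ∷ c ∷ [] ⊆ l →
  T (is123 (a , b , c) ∨ is132 (a , b , c)) → avoids123-132 l ≡ false
pattern⇒¬avoids abc⊆l is-pattern =
  cong not (to T-≡ (any⁺ _ (Any.map (λ { refl → is-pattern }) (triples-complete abc⊆l))))

smallest-first⇒pattern : ∀ {a b c} → a < b → a < c → b ≢ c → T (is123 (a , b , c) ∨ is132 (a , b , c))
smallest-first⇒pattern {a} {b} {c} a<b a<c b≢c with <-cmp b c
... | tri< b<c _   _   = from T-∨ (inj₁ (from T-∧ (<⇒<ᵇ a<b , <⇒<ᵇ b<c)))
... | tri≈ _   b≡c _   = contradiction b≡c b≢c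
... | tri> _   _   c<b = from T-∨ (inj₂ (from T-∧ (<⇒<ᵇ a<c , <⇒<ᵇ c<b)))

≤⇒<ᵇ≡false : ∀ {m n} → n ≤ m → (m <ᵇ n) ≡ false
≤⇒<ᵇ≡false {m} {n} n≤m with m <ᵇ n in eq
... | false = refl
... | true  = contradiction (<ᵇ⇒< m n (subst T (sym eq) tt)) (≤⇒≯ n≤m)

smallest-middle⇒avoids : ∀ {x v y} → v < x → v < y → avoids123-132 (x ∷ v ∷ y ∷ []) ≡ true
smallest-middle⇒avoids {x} {v} {y} v<x v<y
  rewrite ≤⇒<ᵇ≡false (<⇒≤ v<x) | ≤⇒<ᵇ≡false (<⇒≤ v<y) | ∧-zeroʳ (x <ᵇ y) = refl

-- A configuration of `run`: the stack, top first, and the output emitted so far, in reverse.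
Config : Set
Config = List ℕ × List ℕ

runC : List ℕ → Config → List ℕ
runC xs (stack , out) = run xs stack out

contents : Config → List ℕ
contents (stack , out) = stack ++ out

push : ℕ → List ℕ → List ℕ → Config
push x stack out with avoids123-132 (x ∷ stack)
... | true = x ∷ stack , out
push x []          out | false = x ∷ [] , out
push x (y ∷ stack) out | false = push x stack (y ∷ out)

feed : List ℕ → Config → Config
feed []       c = c
feed (x ∷ xs) (stack , out) = feed xs (push x stack out)

step-push : ∀ x xs stack out → step x xs stack out ≡ runC xs (push x stack out)
step-push x xs stack out with avoids123-132 (x ∷ stack)
... | true = refl
step-push x xs []          out | false = refl
step-push x xs (y ∷ stack) out | false = step-push x xs stack (y ∷ out)

runC-++ : ∀ xs ys c → runC (xs ++ ys) c ≡ runC ys (feed xs c)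
runC-++ []       ys c             = refl
runC-++ (x ∷ xs) ys (stack , out) = trans (step-push x (xs ++ ys) stack out) (runC-++ xs ys _)

feed-++ : ∀ xs ys c → feed (xs ++ ys) c ≡ feed ys (feed xs c)
feed-++ []       ys c = refl
feed-++ (x ∷ xs) ys (stack , out) = feed-++ xs ys (push x stack out)

push-↭ : ∀ x stack out → contents (push x stack out) ↭ x ∷ stack ++ out
push-↭ x stack out with avoids123-132 (x ∷ stack)
... | true = ↭-refl
push-↭ x []          out | false = ↭-refl
push-↭ x (y ∷ stack) out | false = ↭-trans (push-↭ x stack (y ∷ out)) (prep x (shift y stack out))

feed-↭ : ∀ xs c → contents (feed xs c) ↭ xs ++ contents c
feed-↭ []       c = ↭-refl
feed-↭ (x ∷ xs) (stack , out) = ↭-trans (feed-↭ xs (push x stack out))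
  (↭-trans (++⁺ˡ xs (push-↭ x stack out)) (shift x xs (stack ++ out)))

push-top : ∀ x stack out → ∃₂ λ stack′ out′ → push x stack out ≡ (x ∷ stack′ , out′)
push-top x stack out with avoids123-132 (x ∷ stack)
... | true = stack , out , refl
push-top x []          out | false = [] , out , refl
push-top x (y ∷ stack) out | false = push-top x stack (y ∷ out)

feed-∷-nonempty : ∀ x xs c → ∃ λ b → ∃₂ λ stack out → feed (x ∷ xs) c ≡ (b ∷ stack , out)
feed-∷-nonempty x []       (stack , out) = x , push-top x stack out
feed-∷-nonempty x (y ∷ ys) (stack , out) = feed-∷-nonempty y ys (push x stack out)

mutual
  run-output-prefix : ∀ xs stack out → ∃ λ rest → run xs stack out ≡ out ʳ++ rest
  run-output-prefix []       stack out = stack , sym (ʳ++-defn out)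
  run-output-prefix (x ∷ xs) stack out = step-output-prefix x xs stack out

  step-output-prefix : ∀ x xs stack out → ∃ λ rest → step x xs stack out ≡ out ʳ++ rest
  step-output-prefix x xs stack out with avoids123-132 (x ∷ stack)
  ... | true = run-output-prefix xs (x ∷ stack) out
  step-output-prefix x xs []          out | false = run-output-prefix xs (x ∷ []) out
  step-output-prefix x xs (y ∷ stack) out | false =
    let rest , eq = step-output-prefix x xs stack (y ∷ out) in y ∷ rest , eq

push-onto-larger : ∀ {v b} stack out → All (v <_) (b ∷ stack) → Unique (b ∷ stack) →
  ∃₂ λ y out′ → push v (b ∷ stack) out ≡ (v ∷ y ∷ [] , out′) × v < y
push-onto-larger []           out (v<b ∷ []) _ = _ , out , refl , v<b
push-onto-larger {v} {b} (b′ ∷ stack) out (v<b ∷ v<b′ ∷ v<stack) ((b≢b′ ∷ _) ∷ u)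
  rewrite pattern⇒¬avoids {l = v ∷ b ∷ b′ ∷ stack} (refl ∷ refl ∷ refl ∷ minimum stack)
                          (smallest-first⇒pattern v<b v<b′ b≢b′)
  = push-onto-larger stack (b ∷ out) (v<b′ ∷ v<stack) u

push-larger-keeps-base : ∀ {x v y} stack out → v < x → v < y →
  ∃₂ λ stack′ out′ → push x (stack ++ v ∷ y ∷ []) out ≡ (stack′ ++ v ∷ y ∷ [] , out′)
push-larger-keeps-base [] out v<x v<y rewrite smallest-middle⇒avoids v<x v<y = _ ∷ [] , out , refl
push-larger-keeps-base {x} {v} {y} (s ∷ stack) out v<x v<y
  with avoids123-132 (x ∷ s ∷ stack ++ v ∷ y ∷ [])
... | true  = x ∷ s ∷ stack , out , refl
... | false = push-larger-keeps-base stack (s ∷ out) v<x v<y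

feed-larger-keeps-base : ∀ {v y} xs stack out → All (v <_) xs → v < y →
  ∃₂ λ stack′ out′ → feed xs (stack ++ v ∷ y ∷ [] , out) ≡ (stack′ ++ v ∷ y ∷ [] , out′)
feed-larger-keeps-base []       stack out []           v<y = stack , out , refl
feed-larger-keeps-base (x ∷ xs) stack out (v<x ∷ v<xs) v<y
  with stack′ , out′ , pushed ← push-larger-keeps-base stack out v<x v<y rewrite pushed
  = feed-larger-keeps-base xs stack′ out′ v<xs v<y

smaller-over-base⇒¬avoids : ∀ {c v y} stack → c < v → v < y →
  avoids123-132 (c ∷ stack ++ v ∷ y ∷ []) ≡ false
smaller-over-base⇒¬avoids stack c<v v<y = pattern⇒¬avoids (refl ∷ Sublist.++⁺ˡ stack ⊆-refl)
  (smallest-first⇒pattern c<v (<-trans c<v v<y) (<⇒≢ v<y))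

push-smaller-pops-base : ∀ {c v y} stack out → c < v → v < y →
  push c (stack ++ v ∷ y ∷ []) out ≡ (c ∷ y ∷ [] , v ∷ stack ʳ++ out)
push-smaller-pops-base [] out c<v v<y rewrite smaller-over-base⇒¬avoids [] c<v v<y = refl
push-smaller-pops-base (s ∷ stack) out c<v v<y
  rewrite smaller-over-base⇒¬avoids (s ∷ stack) c<v v<y
  = push-smaller-pops-base stack (s ∷ out) c<v v<y

runC-from-base : ∀ {v y} C stack out → v < y → Maybe.All (_< v) (head C) →
  ∃₂ λ prefix rest → runC C (stack ++ v ∷ y ∷ [] , out) ≡ prefix ++ v ∷ rest
                   × length prefix ≡ length stack + length out
runC-from-base {v} {y} [] stack out v<y Maybe.nothing =
  reverse out ++ stack , y ∷ [] , sym (++-assoc (reverse out) stack (v ∷ y ∷ [])) , (begin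
    length (reverse out ++ stack)         ≡⟨ length-++ (reverse out) ⟩
    length (reverse out) + length stack   ≡⟨ cong (_+ length stack) (length-reverse out) ⟩
    length out + length stack             ≡⟨ +-comm (length out) (length stack) ⟩
    length stack + length out             ∎)
  where open ≡-Reasoning
runC-from-base {v} {y} (c ∷ C) stack out v<y (Maybe.just c<v) =
  let rest , ran = run-output-prefix C (c ∷ y ∷ []) (v ∷ stack ʳ++ out) in
  reverse (stack ʳ++ out) , rest , (begin
    step c C (stack ++ v ∷ y ∷ []) out         ≡⟨ step-push c C (stack ++ v ∷ y ∷ []) out ⟩
    runC C (push c (stack ++ v ∷ y ∷ []) out)  ≡⟨ cong (runC C) (push-smaller-pops-base stack out c<v v<y) ⟩
    run C (c ∷ y ∷ []) (v ∷ stack ʳ++ out)     ≡⟨ ran ⟩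
    (stack ʳ++ out) ʳ++ v ∷ rest               ≡⟨ ʳ++-defn (stack ʳ++ out) ⟩
    reverse (stack ʳ++ out) ++ v ∷ rest        ∎) ,
  trans (length-reverse (stack ʳ++ out)) (length-ʳ++ stack)
  where open ≡-Reasoning

feed-start-↭ : ∀ {xs stack out} → feed xs ([] , []) ≡ (stack , out) → stack ++ out ↭ xs
feed-start-↭ {xs} fed =
  subst (λ c → contents c ↭ xs) fed (↭-trans (feed-↭ xs ([] , [])) (↭-reflexive (++-identityʳ xs)))

feed-block : ∀ {v} a A B → All (v <_) (a ∷ A) → Unique (a ∷ A) → All (v <_) B →
  ∃ λ y → ∃₂ λ stack out → feed (a ∷ A ++ v ∷ B) ([] , []) ≡ (stack ++ v ∷ y ∷ [] , out) × v < y
feed-block {v} a A B v<A uA v<B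
  with b , stack , out , fedA ← feed-∷-nonempty a A ([] , [])
  with y , out′ , pushed , v<y ← push-onto-larger stack out
         (All.++⁻ˡ (b ∷ stack) (All-resp-↭ (↭-sym (feed-start-↭ fedA)) v<A))
         (Unique-++⁻ˡ (b ∷ stack) (Unique-↭ (feed-start-↭ fedA) uA))
  with stack′ , out″ , fedB ← feed-larger-keeps-base B [] out′ v<B v<y
  = y , stack′ , out″ , (begin
    feed (a ∷ A ++ v ∷ B) ([] , [])       ≡⟨ feed-++ (a ∷ A) (v ∷ B) ([] , []) ⟩
    feed (v ∷ B) (feed (a ∷ A) ([] , []))  ≡⟨ cong (feed (v ∷ B)) fedA ⟩
    feed B (push v (b ∷ stack) out)        ≡⟨ cong (feed B) pushed ⟩
    feed B (v ∷ y ∷ [] , out′)             ≡⟨ fedB ⟩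
    (stack′ ++ v ∷ y ∷ [] , out″)          ∎) , v<y
  where open ≡-Reasoning

s123-132-block : ∀ {v} a A B C → All (v <_) (a ∷ A) → Unique (a ∷ A) → All (v <_) B →
  Maybe.All (_< v) (head C) →
  nth1 (s123-132 ((a ∷ A ++ v ∷ B) ++ C)) (length (a ∷ A ++ v ∷ B) ∸ 1) ≡ just v
s123-132-block {v} a A B C v<A uA v<B C-below
  with y , stack , out , fed , v<y ← feed-block a A B v<A uA v<B
  with prefix , rest , ran , |prefix| ← runC-from-base C stack out v<y C-below
  = begin
    nth1 (s123-132 (P ++ C)) (length P ∸ 1)          ≡⟨ cong₂ nth1 output (cong (_∸ 1) position) ⟩
    nth1 (prefix ++ v ∷ rest) (suc (length prefix))  ≡⟨ nth1-++-∷ prefix ⟩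
    just v                                            ∎
  where
  open ≡-Reasoning
  P = a ∷ A ++ v ∷ B
  output : s123-132 (P ++ C) ≡ prefix ++ v ∷ rest
  output = trans (runC-++ P C ([] , [])) (trans (cong (runC C) fed) ran)
  position : length P ≡ suc (suc (length prefix))
  position = begin
    length P                               ≡⟨ sym (↭-length (feed-start-↭ {P} fed)) ⟩
    length ((stack ++ v ∷ y ∷ []) ++ out)  ≡⟨ cong length (++-assoc stack (v ∷ y ∷ []) out) ⟩
    length (stack ++ v ∷ y ∷ out)          ≡⟨ length-++ stack ⟩
    length stack + suc (suc (length out))  ≡⟨ +-suc (length stack) (suc (length out)) ⟩
    suc (length stack + suc (length out))  ≡⟨ cong suc (+-suc (length stack) (length out)) ⟩
    suc (suc (length stack + length out))  ≡⟨ cong (suc ∘ suc) (sym |prefix|) ⟩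
    suc (suc (length prefix))              ∎

head-drop-below : ∀ π j {v} → prefMin π j ≡ just v → (j < length π → prefMin π (suc j) ≢ just v) →
  Maybe.All (_< v) (head (drop j π))
head-drop-below π j {v} min≡v maximal with drop j π in dropped
... | []    = Maybe.nothing
... | c ∷ _ with c <? v
...   | yes c<v = Maybe.just c<v
...   | no  c≮v = contradiction
  (trans (cong minList (take-suc-drop j π dropped)) (minList-∷ʳ {take j π} min≡v (≮⇒≥ c≮v)))
  (maximal (drop-∷⇒<length j π dropped))

prefix-minimum-split : ∀ π j {v} → Unique π → head π ≢ just v → prefMin π j ≡ just v →
  ∃₂ λ a A → ∃ λ B → take j π ≡ a ∷ A ++ v ∷ B × All (v <_) (a ∷ A) × Unique (a ∷ A) × All (v <_) B
prefix-minimum-split π j {v} uπ head≢v min≡v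
  with v∈P , v≤P ← minList-sound {take j π} min≡v
  with ∈-∃++ v∈P
... | []    , B , P≡ = contradiction (head-take j π P≡) head≢v
... | a ∷ A , B , P≡ =
  let v<A , v<B = Unique⇒strict-minimum (a ∷ A) uP (subst (All (v ≤_)) P≡ v≤P) in
  a , A , B , P≡ , v<A , Unique-++⁻ˡ (a ∷ A) uP , v<B
  where
  uP : Unique (a ∷ A ++ v ∷ B)
  uP = subst Unique P≡ (Unique.take⁺ j uπ)

s123-132-at-last-prefix-minimum : ∀ π j {v} → Unique π → head π ≢ just v → j ≤ length π →
  prefMin π j ≡ just v → (j < length π → prefMin π (suc j) ≢ just v) →
  nth1 (s123-132 π) (j ∸ 1) ≡ just v
s123-132-at-last-prefix-minimum π j {v} uπ head≢v j≤|π| min≡v maximal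
  with a , A , B , P≡ , v<A , uA , v<B ← prefix-minimum-split π j uπ head≢v min≡v
  = begin
    nth1 (s123-132 π) (j ∸ 1)
      ≡⟨ cong₂ (λ xs i → nth1 (s123-132 xs) (i ∸ 1)) π≡ j≡ ⟩
    nth1 (s123-132 ((a ∷ A ++ v ∷ B) ++ C)) (length (a ∷ A ++ v ∷ B) ∸ 1)
      ≡⟨ s123-132-block a A B C v<A uA v<B (head-drop-below π j min≡v maximal) ⟩
    just v
      ∎
  where
  open ≡-Reasoning
  C = drop j π
  π≡ : π ≡ (a ∷ A ++ v ∷ B) ++ C
  π≡ = trans (sym (take++drop≡id j π)) (cong (_++ C) P≡)
  j≡ : j ≡ length (a ∷ A ++ v ∷ B)
  j≡ = trans (sym (m≤n⇒m⊓n≡m j≤|π|)) (trans (sym (length-take j π)) (cong length P≡))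

lemma3p3 : (n : ℕ) (π : List ℕ) → π ↭ oneTo n →
    (i : ℕ) → 1 < i → i ≤ n → (v : ℕ) → nth1 π i ≡ just v → prefMin π i ≡ just v →
    (j : ℕ) → j ≤ n → prefMin π j ≡ just v →
    ((k : ℕ) → j < k → k ≤ n → prefMin π k ≢ just v) →
    nth1 (s123-132 π) (j ∸ 1) ≡ just v
lemma3p3 n π π↭ i 1<i _ v πᵢ≡v _ j j≤n min≡v maximal =
  s123-132-at-last-prefix-minimum π j uπ (later-entry≢head uπ 1<i πᵢ≡v)
    (subst (j ≤_) (sym |π|≡n) j≤n) min≡v (λ j<|π| → maximal (suc j) ≤-refl (subst (j <_) |π|≡n j<|π|))
  where
  uπ : Unique π
  uπ = Unique-↭ π↭ (Unique.map⁺ suc-injective (Unique.upTo⁺ n))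
  |π|≡n : length π ≡ n
  |π|≡n = trans (↭-length π↭) (trans (length-map suc (upTo n)) (length-upTo n))
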